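{- Let $\vdash$ be a regular entailment relation for a commutative preordered group $G$, let $a,x\in G$ and let $p,q$ be integers with $0\leqslant p\leqslant q$. Then $a,a+qx\vdash a+px$.
   Context: A commutative preordered group is an abelian group $G$ with a preorder $\leqslant$ such that $a\leqslant b$ implies $a+c\leqslant b+c$. $A,B,A',B'$ denote nonempty finite subsets of $G$; $a$ stands for $\{a\}$, commas denote unions, $A+y=\{a+y:a\in A\}$, $px$ is the $p$-fold multiple of $x$. A regular entailment relation for $G$ is a relation $A\vdash B$ between nonempty finite subsets such that: (R1) $A\vdash B$ if $A\supseteq A'$, $B\supseteq B'$ and $A'\vdash B'$; (R2) $A\vdash B$ if $A,y\vdash B$ and $A\vdash B,y$; (R3) $a\vdash b$ if $a\leqslant b$; (R4) $A\vdash B$ if $A+y\vdash B+y$; (R5) $a+u,b+v\vdash a+b,u+v$ for all $a,b,u,v\in G$. -}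

module Defs where

open import Level using (Level; _⊔_) renaming (suc to lsuc)
open import Data.Nat using (ℕ; zero; suc)
open import Data.List.NonEmpty using (List⁺; [_]; _⁺++⁺_; toList) renaming (map to map⁺)
open import Data.List.Membership.Propositional using (_∈_)
open import Relation.Binary.PropositionalEquality using (_≡_)
open import Relation.Binary.Structures using (IsPreorder)
open import Algebra.Structures using (IsAbelianGroup)

record CommPreorderedGroup (c ℓ : Level) : Set (lsuc (c ⊔ ℓ)) where
  infixl 6 _+_
  infix 4 _≤_
  field
    Carrier        : Set c
    _+_            : Carrier → Carrier → Carrier
    0#             : Carrier
    -_             : Carrier → Carrier
    _≤_            : Carrier → Carrier → Set ℓ
    isAbelianGroup : IsAbelianGroup _≡_ _+_ 0# -_
    isPreorder     : IsPreorder _≡_ _≤_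
    +-mono-≤       : ∀ {a b} c → a ≤ b → a + c ≤ b + c

  infixr 7 _·_
  _·_ : ℕ → Carrier → Carrier
  zero  · x = 0#
  suc p · x = x + p · x

module _ {c ℓ : Level} (G : CommPreorderedGroup c ℓ) where
  open CommPreorderedGroup G

  -- Nonempty finite subsets of G are represented by nonempty lists.
  FinSet⁺ : Set c
  FinSet⁺ = List⁺ Carrier

  _⊇_ : FinSet⁺ → FinSet⁺ → Set c
  A ⊇ A' = ∀ {z} → z ∈ toList A' → z ∈ toList A

  _+ˢ_ : FinSet⁺ → Carrier → FinSet⁺
  A +ˢ y = map⁺ (_+ y) A

  record IsRegularEntailment {ℓ′ : Level} (_⊢_ : FinSet⁺ → FinSet⁺ → Set ℓ′)
         : Set (c ⊔ ℓ ⊔ ℓ′) where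
    field
      R1 : ∀ {A B A′ B′} → A ⊇ A′ → B ⊇ B′ → A′ ⊢ B′ → A ⊢ B
      R2 : ∀ {A B} y → (A ⁺++⁺ [ y ]) ⊢ B → A ⊢ (B ⁺++⁺ [ y ]) → A ⊢ B
      R3 : ∀ {a b} → a ≤ b → [ a ] ⊢ [ b ]
      R4 : ∀ {A B} y → (A +ˢ y) ⊢ (B +ˢ y) → A ⊢ B
      R5 : ∀ a b u v →
             (([ a + u ]) ⁺++⁺ [ b + v ]) ⊢ (([ a + b ]) ⁺++⁺ [ u + v ])

-- One application of (R5) gives a, b + c ⊢ a + b, c.  Cutting on c = a + n·x
-- yields a, a + (n+1)·x ⊢ a + x by induction on n.  For p ≤ q one then cuts on
-- a + x and applies the induction hypothesis to the pair a + x, a + q·x.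
module Submission where

open import Defs
open import Level using (Level)
open import Data.Nat using (ℕ; zero; suc; z≤n; s≤s) renaming (_≤_ to _≤ℕ_)
open import Data.List.NonEmpty using ([_]; _⁺++⁺_)
open import Data.List.Relation.Unary.Any using (here; there)
open import Relation.Binary.PropositionalEquality using (_≡_; refl; sym; trans; cong; cong₂; subst; subst₂)
open import Algebra.Structures using (IsAbelianGroup)
open import Relation.Binary.Structures using (IsPreorder)

module RegularEntailment {c ℓ ℓ′ : Level} (G : CommPreorderedGroup c ℓ)
    (_⊢_ : FinSet⁺ G → FinSet⁺ G → Set ℓ′)
    (reg : IsRegularEntailment G _⊢_) where

  open CommPreorderedGroup G
  open IsRegularEntailment reg
  open IsAbelianGroup isAbelianGroup using (assoc; comm; identityˡ; identityʳ)

  pair : Carrier → Carrier → FinSet⁺ G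
  pair u v = [ u ] ⁺++⁺ [ v ]

  ⊢-projˡ : ∀ {u v w} → u ≡ w → pair u v ⊢ [ w ]
  ⊢-projˡ refl = R1 (λ { (here e) → here e ; (there ()) }) (λ z → z)
                    (R3 (IsPreorder.refl isPreorder))

  ⊢-projʳ : ∀ {u v w} → v ≡ w → pair u v ⊢ [ w ]
  ⊢-projʳ refl = R1 (λ { (here e) → there (here e) ; (there ()) }) (λ z → z)
                    (R3 (IsPreorder.refl isPreorder))

  cut-replacingʳ : ∀ {u v b w} → pair u v ⊢ pair w b → pair u b ⊢ [ w ] → pair u v ⊢ [ w ]
  cut-replacingʳ {u} {b = b} u,v⊢w,b u,b⊢w =
    R2 b (R1 {A′ = pair u b} (λ { (here e)           → here e
                                ; (there (here e))   → there (there (here e))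
                                ; (there (there ())) })
             (λ z → z) u,b⊢w)
         u,v⊢w,b

  cut-replacingˡ : ∀ {u v b w} → pair u v ⊢ [ b ] → pair b v ⊢ [ w ] → pair u v ⊢ [ w ]
  cut-replacingˡ {v = v} {b} u,v⊢b b,v⊢w =
    R2 b (R1 {A′ = pair b v} (λ { (here e)           → there (there (here e))
                                ; (there (here e))   → there (here e)
                                ; (there (there ())) })
             (λ z → z) b,v⊢w)
         (R1 (λ z → z) (λ { (here e) → there (here e) ; (there ()) }) u,v⊢b)

  sum-split : ∀ a b d → pair a (b + d) ⊢ pair (a + b) d
  sum-split a b d =
    subst₂ _⊢_ (cong₂ pair (identityʳ a) refl) (cong₂ pair refl (identityˡ d))
           (R5 a b 0# d)

  +-·-swap : ∀ a x n → x + (a + n · x) ≡ a + suc n · x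
  +-·-swap a x n = trans (sym (assoc x a (n · x)))
                         (trans (cong (_+ n · x) (comm x a)) (assoc a x (n · x)))

  ⊢-first-step : ∀ x a n → pair a (a + suc n · x) ⊢ [ a + x ]
  ⊢-first-step x a zero    = ⊢-projʳ (cong (a +_) (identityʳ x))
  ⊢-first-step x a (suc n) =
    cut-replacingʳ (subst (λ v → pair a v ⊢ pair (a + x) (a + suc n · x))
                          (+-·-swap a x (suc n))
                          (sum-split a x (a + suc n · x)))
                   (⊢-first-step x a n)

  ⊢-between : ∀ x {p q} → p ≤ℕ q → ∀ a → pair a (a + q · x) ⊢ [ a + p · x ]
  ⊢-between x z≤n a = ⊢-projˡ (sym (identityʳ a))
  ⊢-between x (s≤s {p} {q} p≤q) a =
    cut-replacingˡ (⊢-first-step x a q)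
                   (subst₂ (λ v w → pair (a + x) v ⊢ [ w ])
                           (assoc a x (q · x)) (assoc a x (p · x))
                           (⊢-between x p≤q (a + x)))

lemma1p5 : ∀ {c ℓ ℓ′ : Level} (G : CommPreorderedGroup c ℓ)
             (_⊢_ : FinSet⁺ G → FinSet⁺ G → Set ℓ′) →
             IsRegularEntailment G _⊢_ →
             let open CommPreorderedGroup G in
             (a x : Carrier) (p q : ℕ) → p ≤ℕ q →
             ([ a ] ⁺++⁺ [ a + q · x ]) ⊢ [ a + p · x ]
lemma1p5 G _⊢_ reg a x p q p≤q = RegularEntailment.⊢-between G _⊢_ reg x p≤q a
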